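{- Let $k\ge 1$ and $n\ge 0$ be integers. Then $\mathcal{S}_n(a\text{ - }a_1\cdots a_k)=\mathcal{S}_n(aa_1\cdots a_k)$, and consequently the exponential generating function $\sum_{n\ge0}|\mathcal{S}_n(aa_1\cdots a_k)|x^n/n!$ equals $\exp\left(\sum_{i=1}^{k}x^i/i\right)$.
   Context: $\mathcal{S}_n$ is the set of permutations of $\{1,\dots,n\}$ written as words $\pi_1\cdots\pi_n$. Both patterns are built on the poset with elements $a,a_1,\dots,a_k$ whose only relations are $a<a_i$ for all $i$. An occurrence of $a\text{ - }a_1\cdots a_k$ in $\pi$ is a pair of indices $i<j$ with $j+k-1\le n$ such that $\pi_i<\pi_{j+t}$ for $t=0,\dots,k-1$. An occurrence of the segmented pattern $aa_1\cdots a_k$ in $\pi$ is an index $i$ with $i+k\le n$ such that $\pi_i<\pi_{i+t}$ for all $t=1,\dots,k$. $\mathcal{S}_n(p)$ denotes the set of permutations in $\mathcal{S}_n$ with no occurrence of $p$. -}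

module Defs where

open import Data.Nat as ℕ using (ℕ; zero; suc; _<_; _≤_; _+_; _∸_; _<?_; _≤?_)
open import Data.Nat using (_!)
open import Data.Fin as Fin using (Fin; toℕ)
open import Data.Fin.Properties using (any?; all?)
import Data.Fin.Properties as FinP
open import Data.Vec as Vec using (Vec; []; _∷_; lookup)
open import Data.List as List using (List; [_]; concatMap; map; allFin; filter; length)
open import Data.Product using (∃; _×_; _,_)
open import Data.Integer as ℤ using (+_)
open import Data.Rational as ℚ using (ℚ; 0ℚ; 1ℚ)
open import Relation.Nullary using (Dec; yes; no; ¬_; ¬?)
open import Relation.Nullary.Decidable using (_×-dec_; _→-dec_)
open import Relation.Binary.PropositionalEquality using (_≡_)
open import Data.Nat.Properties using (_!≢0)

-- Permutations of {1..n} as words π₀ ⋯ π_{n-1} (0-indexed positions,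
-- values in Fin n, i.e. {0..n-1}; only relative order matters).

Word : ℕ → Set
Word n = Vec (Fin n) n

IsPerm : ∀ {n} → Word n → Set
IsPerm {n} π = ∀ (i j : Fin n) → lookup π i ≡ lookup π j → i ≡ j

isPerm? : ∀ {n} (π : Word n) → Dec (IsPerm π)
isPerm? π = all? λ i → all? λ j → (lookup π i Fin.≟ lookup π j) →-dec (i Fin.≟ j)

-- value at a natural-number position (0 outside the range; only used
-- at positions proven to be in range)
at : ∀ {n} → Word n → ℕ → ℕ
at {n} π m with m <? n
... | yes m<n = toℕ (lookup π (Fin.fromℕ< m<n))
... | no _ = 0

OccDashed : ∀ {n} (k : ℕ) → Word n → Set
OccDashed {n} k π =
  ∃ λ (i : Fin n) → ∃ λ (j : Fin n) →
    (toℕ i < toℕ j) × (toℕ j + k ≤ n) ×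
    (∀ (t : Fin k) → at π (toℕ i) < at π (toℕ j + toℕ t))

OccSeg : ∀ {n} (k : ℕ) → Word n → Set
OccSeg {n} k π =
  ∃ λ (i : Fin n) →
    (toℕ i + k < n) ×
    (∀ (t : Fin k) → at π (toℕ i) < at π (toℕ i + suc (toℕ t)))

occDashed? : ∀ {n} k (π : Word n) → Dec (OccDashed k π)
occDashed? {n} k π = any? λ i → any? λ j →
  (toℕ i <? toℕ j) ×-dec ((toℕ j + k ≤? n) ×-dec
  all? (λ t → at π (toℕ i) <? at π (toℕ j + toℕ t)))

occSeg? : ∀ {n} k (π : Word n) → Dec (OccSeg k π)
occSeg? {n} k π = any? λ i →
  (toℕ i + k <? n) ×-dec all? (λ t → at π (toℕ i) <? at π (toℕ i + suc (toℕ t)))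

words : (n m : ℕ) → List (Vec (Fin n) m)
words n zero = [ [] ]
words n (suc m) = concatMap (λ x → map (x ∷_) (words n m)) (allFin n)

perms : (n : ℕ) → List (Word n)
perms n = filter isPerm? (words n n)

countSegAvoid : (k n : ℕ) → ℕ
countSegAvoid k n = length (filter (λ π → ¬? (occSeg? k π)) (perms n))

Series : Set
Series = ℕ → ℚ

sumTo : (ℕ → ℚ) → ℕ → ℚ
sumTo f zero = f 0
sumTo f (suc n) = sumTo f n ℚ.+ f (suc n)

_⊛_ : Series → Series → Series
(f ⊛ g) n = sumTo (λ i → f i ℚ.* g (n ∸ i)) n

_^ˢ_ : Series → ℕ → Series
(f ^ˢ zero) zero = 1ℚ
(f ^ˢ zero) (suc _) = 0ℚ
f ^ˢ suc m = f ⊛ (f ^ˢ m)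

-- exp(f) = Σ_m f^m / m!, for f with zero constant term; then the
-- coefficient of x^n only receives contributions from m ≤ n.
expS : Series → Series
expS f n = sumTo (λ m → (f ^ˢ m) n ℚ.* (ℚ._/_ (+ 1) (m !) {{m !≢0}})) n

logSeries : ℕ → Series
logSeries k zero = 0ℚ
logSeries k (suc i) with suc i ≤? k
... | yes _ = (+ 1) ℚ./ suc i
... | no _ = 0ℚ

_/fact_ : ℤ.ℤ → ℕ → ℚ
z /fact n = ℚ._/_ z (n !) {{n !≢0}}

-- Dashed to segmented: if π_i < π_j, …, π_{j+k-1} with i + 1 < j, compare π_{j-1} with π_i. If it
-- is larger it joins the window and the gap shrinks; if it is smaller it starts a segmented occurrence;
-- injectivity excludes equality.
--
-- Counting: the smallest letter 0 of a repetition-free word over N+1 letters, if it occurs, splits the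
-- word as σ 0 τ with σ, τ over the other N letters, and the word avoids aa₁⋯a_k iff σ does and |τ| < k.
-- Hence the number A(N, m) of avoiding repetition-free words of length m over N letters satisfies
-- A(N+1, m) = A(N, m) + Σ_{p+q+1=m} [q < k] (N-p)↓q A(N, p). This recurrence is solved by
-- A(N, m) = N↓m · e_m with e = exp L, L = Σ_{i≤k} xⁱ/i, because coefficientwise the equation
-- x e′ = x L′ e reads (m+1) e_{m+1} = Σ_{m-p<k} e_p. Permutations are the case N = m = n, with n↓n = n!.

module Submission where

open import Defs
open import Data.Nat as ℕ using (ℕ; zero; suc; pred; _≤_; _<_; z≤n; s≤s; _!)
open import Data.Nat.Properties as ℕP using (_!≢0)
open import Data.Nat.Solver using (module +-*-Solver)
import Data.Integer as ℤ
import Data.Integer.Properties as ℤP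
open import Data.Rational as ℚ using (ℚ; 0ℚ; 1ℚ)
import Data.Rational.Properties as ℚP
import Data.Rational.Unnormalised as ℚᵘ
import Data.Rational.Unnormalised.Properties as ℚᵘP
import Data.Rational.Solver as ℚSolver
open import Relation.Nullary using (yes; no)
open import Data.Sum using (inj₁; inj₂)
open import Data.Bool using (Bool; true; false)
open import Data.Fin as Fin using (Fin; toℕ)
open import Data.List using (List; []; _∷_; _++_; map; length)
import Data.List.Properties as ListP
open import Function using (_∘_)
open import Function.Bundles using (Equivalence; _⇔_; mk⇔)
open import Relation.Binary.PropositionalEquality

⟦_⟧ : Bool → ℕ
⟦ true  ⟧ = 1
⟦ false ⟧ = 0

-- Falling factorials

module _ where
  open import Data.Nat using (_+_; _*_; _∸_)

  infixl 8 _↓_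

  _↓_ : ℕ → ℕ → ℕ
  n ↓ zero  = 1
  n ↓ suc k = n * (pred n ↓ k)

  ↓-diagonal : ∀ n → n ↓ n ≡ n !
  ↓-diagonal zero    = refl
  ↓-diagonal (suc n) = cong (suc n *_) (↓-diagonal n)

  ↓-+ : ∀ n p q → n ↓ (p + q) ≡ n ↓ p * ((n ∸ p) ↓ q)
  ↓-+ n       zero    q = sym (ℕP.+-identityʳ (n ↓ q))
  ↓-+ zero    (suc p) q = refl
  ↓-+ (suc n) (suc p) q = trans (cong (suc n *_) (↓-+ n p q)) (sym (ℕP.*-assoc (suc n) (n ↓ p) _))

  ↓-pascal : ∀ n k → n ↓ suc k + suc k * n ↓ k ≡ suc n ↓ suc k
  ↓-pascal zero    zero    = refl
  ↓-pascal zero    (suc k) = ℕP.*-zeroʳ (suc (suc k))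
  ↓-pascal (suc n) zero    = solve 1 (λ n → (con 1 :+ n) :* con 1 :+ con 1 :* con 1
                                          := (con 2 :+ n) :* con 1) refl n
    where open +-*-Solver
  ↓-pascal (suc n) (suc k) = begin
    suc n * A + suc (suc k) * (suc n * B)
      ≡⟨ solve 4 (λ n k a b → (con 1 :+ n) :* a :+ (con 2 :+ k) :* ((con 1 :+ n) :* b)
                           := (con 1 :+ n) :* (a :+ (con 1 :+ k) :* b) :+ (con 1 :+ n) :* b) refl n k A B ⟩
    suc n * (A + suc k * B) + suc n * B
      ≡⟨ cong (λ x → suc n * x + suc n * B) (↓-pascal n k) ⟩
    suc n * (suc n * B) + suc n * B
      ≡⟨ solve 2 (λ n b → (con 1 :+ n) :* ((con 1 :+ n) :* b) :+ (con 1 :+ n) :* b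
                       := (con 2 :+ n) :* ((con 1 :+ n) :* b)) refl n B ⟩
    suc (suc n) * (suc n * B)
      ∎
    where
    open ≡-Reasoning
    open +-*-Solver
    A = n ↓ suc k
    B = n ↓ k

-- Formal power series

fromℕ : ℕ → ℚ
fromℕ n = ℤ.+ n ℚ./ 1

module _ where
  open import Data.Integer using (+_)
  open import Data.Rational using (_+_; _*_; fromℚᵘ)
  open ℚᵘ using (mkℚᵘ; *≡*)
  open ℚP using (toℚᵘ-injective; toℚᵘ-fromℚᵘ)

  fromℚᵘ-+ : ∀ p q r → p ℚᵘ.+ q ℚᵘ.≃ r → fromℚᵘ p + fromℚᵘ q ≡ fromℚᵘ r
  fromℚᵘ-+ p q r p+q≃r = toℚᵘ-injective (ℚᵘP.≃-trans (ℚP.toℚᵘ-homo-+ (fromℚᵘ p) (fromℚᵘ q))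
    (ℚᵘP.≃-trans (ℚᵘP.+-cong (toℚᵘ-fromℚᵘ p) (toℚᵘ-fromℚᵘ q))
      (ℚᵘP.≃-trans p+q≃r (ℚᵘP.≃-sym (toℚᵘ-fromℚᵘ r)))))

  fromℚᵘ-* : ∀ p q r → p ℚᵘ.* q ℚᵘ.≃ r → fromℚᵘ p * fromℚᵘ q ≡ fromℚᵘ r
  fromℚᵘ-* p q r p*q≃r = toℚᵘ-injective (ℚᵘP.≃-trans (ℚP.toℚᵘ-homo-* (fromℚᵘ p) (fromℚᵘ q))
    (ℚᵘP.≃-trans (ℚᵘP.*-cong (toℚᵘ-fromℚᵘ p) (toℚᵘ-fromℚᵘ q))
      (ℚᵘP.≃-trans p*q≃r (ℚᵘP.≃-sym (toℚᵘ-fromℚᵘ r)))))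

  fromℕ-+ : ∀ m n → fromℕ (m ℕ.+ n) ≡ fromℕ m + fromℕ n
  fromℕ-+ m n = sym (fromℚᵘ-+ (mkℚᵘ (+ m) 0) (mkℚᵘ (+ n) 0) (mkℚᵘ (+ (m ℕ.+ n)) 0) (*≡* eq))
    where
    eq : (+ m ℤ.* + 1 ℤ.+ + n ℤ.* + 1) ℤ.* + 1 ≡ + (m ℕ.+ n) ℤ.* + 1
    eq rewrite ℤP.*-identityʳ (+ m) | ℤP.*-identityʳ (+ n) = refl

  fromℕ-* : ∀ m n → fromℕ (m ℕ.* n) ≡ fromℕ m * fromℕ n
  fromℕ-* m n = sym (fromℚᵘ-* (mkℚᵘ (+ m) 0) (mkℚᵘ (+ n) 0) (mkℚᵘ (+ (m ℕ.* n)) 0) (*≡* eq))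
    where
    eq : (+ m ℤ.* + n) ℤ.* + 1 ≡ + (m ℕ.* n) ℤ.* + 1
    eq = cong (ℤ._* + 1) (sym (ℤP.pos-* m n))

  /-as-* : ∀ a d .{{_ : ℕ.NonZero d}} → + a ℚ./ d ≡ fromℕ a * (+ 1 ℚ./ d)
  /-as-* a (suc d) = sym (fromℚᵘ-* (mkℚᵘ (+ a) 0) (mkℚᵘ (+ 1) d) (mkℚᵘ (+ a) d) (*≡* eq))
    where
    eq : (+ a ℤ.* + 1) ℤ.* + suc d ≡ + a ℤ.* + (1 ℕ.* suc d)
    eq rewrite ℤP.*-identityʳ (+ a) | ℕP.*-identityˡ (suc d) = refl

  fromℕ-*-inverse : ∀ d .{{_ : ℕ.NonZero d}} → fromℕ d * (+ 1 ℚ./ d) ≡ 1ℚ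
  fromℕ-*-inverse (suc d) = fromℚᵘ-* (mkℚᵘ (+ suc d) 0) (mkℚᵘ (+ 1) d) (mkℚᵘ (+ 1) 0) (*≡* eq)
    where
    eq : (+ suc d ℤ.* + 1) ℤ.* + 1 ≡ + 1 ℤ.* + (1 ℕ.* suc d)
    eq = trans (ℤP.*-identityʳ (+ suc d ℤ.* + 1))
      (trans (ℤP.*-identityʳ (+ suc d))
        (sym (trans (ℤP.*-identityˡ (+ (1 ℕ.* suc d))) (cong +_ (ℕP.*-identityˡ (suc d))))))


module _ where
  open import Data.Integer using (+_)
  open import Data.Rational using (_+_; _*_)
  open import Data.Nat using (_∸_; _≤?_) renaming (_+_ to _+ℕ_)
  open import Data.Bool using (if_then_else_)
  open import Relation.Nullary using (does)
  open import Relation.Nullary.Decidable using (dec-true; dec-false)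
  open ℚSolver.+-*-Solver using (solve; _:+_; _:*_; _:=_; con)
  open ≡-Reasoning

  sumTo-cong : ∀ n {f g : ℕ → ℚ} → (∀ i → i ≤ n → f i ≡ g i) → sumTo f n ≡ sumTo g n
  sumTo-cong zero    f≗g = f≗g 0 z≤n
  sumTo-cong (suc n) f≗g =
    cong₂ _+_ (sumTo-cong n (λ i i≤n → f≗g i (ℕP.m≤n⇒m≤1+n i≤n))) (f≗g (suc n) ℕP.≤-refl)

  sumTo-+ : ∀ n (f g : ℕ → ℚ) → sumTo (λ i → f i + g i) n ≡ sumTo f n + sumTo g n
  sumTo-+ zero    f g = refl
  sumTo-+ (suc n) f g = trans (cong (_+ (f (suc n) + g (suc n))) (sumTo-+ n f g))
    (solve 4 (λ a b c d → (a :+ b) :+ (c :+ d) := (a :+ c) :+ (b :+ d)) refl (sumTo f n) (sumTo g n) (f (suc n)) (g (suc n)))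

  sumTo-*ˡ : ∀ n c (f : ℕ → ℚ) → sumTo (λ i → c * f i) n ≡ c * sumTo f n
  sumTo-*ˡ zero    c f = refl
  sumTo-*ˡ (suc n) c f = trans (cong (_+ c * f (suc n)) (sumTo-*ˡ n c f)) (sym (ℚP.*-distribˡ-+ c (sumTo f n) (f (suc n))))

  sumTo-*ʳ : ∀ n c (f : ℕ → ℚ) → sumTo (λ i → f i * c) n ≡ sumTo f n * c
  sumTo-*ʳ zero    c f = refl
  sumTo-*ʳ (suc n) c f = trans (cong (_+ f (suc n) * c) (sumTo-*ʳ n c f)) (sym (ℚP.*-distribʳ-+ c (sumTo f n) (f (suc n))))

  sumTo-head : ∀ n (f : ℕ → ℚ) → sumTo f (suc n) ≡ f 0 + sumTo (λ i → f (suc i)) n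
  sumTo-head zero    f = refl
  sumTo-head (suc n) f = trans (cong (_+ f (suc (suc n))) (sumTo-head n f)) (ℚP.+-assoc (f 0) _ _)

  sumTo-truncate : ∀ {b} n (f : ℕ → ℚ) → b ≤ n → (∀ i → b < i → i ≤ n → f i ≡ 0ℚ) →
                   sumTo f n ≡ sumTo f b
  sumTo-truncate zero    f z≤n _ = refl
  sumTo-truncate {b} (suc n) f b≤1+n f≡0 with ℕP.m≤n⇒m<n∨m≡n b≤1+n
  ... | inj₂ refl      = refl
  ... | inj₁ (s≤s b≤n) = begin
    sumTo f n + f (suc n)   ≡⟨ cong₂ _+_ (sumTo-truncate n f b≤n (λ i b<i i≤n → f≡0 i b<i (ℕP.m≤n⇒m≤1+n i≤n)))
                                          (f≡0 (suc n) (s≤s b≤n) ℕP.≤-refl) ⟩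
    sumTo f b + 0ℚ          ≡⟨ ℚP.+-identityʳ _ ⟩
    sumTo f b               ∎

  sumTo-zero : ∀ n {f : ℕ → ℚ} → (∀ i → i ≤ n → f i ≡ 0ℚ) → sumTo f n ≡ 0ℚ
  sumTo-zero n {f} f≡0 = trans (sumTo-truncate n f z≤n (λ i _ i≤n → f≡0 i i≤n)) (f≡0 0 z≤n)

  sumTo-comm : ∀ n m (F : ℕ → ℕ → ℚ) →
    sumTo (λ i → sumTo (F i) m) n ≡ sumTo (λ j → sumTo (λ i → F i j) n) m
  sumTo-comm zero    m F = refl
  sumTo-comm (suc n) m F = trans (cong (_+ sumTo (F (suc n)) m) (sumTo-comm n m F))
    (sym (sumTo-+ m (λ j → sumTo (λ i → F i j) n) (F (suc n))))

  sumTo-reverse : ∀ n (f : ℕ → ℚ) → sumTo f n ≡ sumTo (λ i → f (n ∸ i)) n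
  sumTo-reverse zero    f = refl
  sumTo-reverse (suc n) f = begin
    sumTo f n + f (suc n)                          ≡⟨ cong (_+ f (suc n)) (sumTo-reverse n f) ⟩
    sumTo (λ i → f (n ∸ i)) n + f (suc n)          ≡⟨ ℚP.+-comm _ (f (suc n)) ⟩
    f (suc n) + sumTo (λ i → f (suc n ∸ suc i)) n  ≡⟨ sumTo-head n (λ i → f (suc n ∸ i)) ⟨
    sumTo (λ i → f (suc n ∸ i)) (suc n)            ∎

  sumTo-∸ : ∀ a n (g : ℕ → ℚ) → a ≤ n →
    sumTo g (n ∸ a) ≡ sumTo (λ j → if does (a +ℕ j ≤? n) then g j else 0ℚ) n
  sumTo-∸ a n g a≤n = sym (trans (sumTo-truncate n _ (ℕP.m∸n≤m n a) switchedOff) (sumTo-cong (n ∸ a) kept))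
    where
    kept : ∀ j → j ≤ n ∸ a → (if does (a +ℕ j ≤? n) then g j else 0ℚ) ≡ g j
    kept j j≤n∸a = cong (if_then g j else 0ℚ) (dec-true (a +ℕ j ≤? n)
      (subst (a +ℕ j ≤_) (ℕP.m+[n∸m]≡n a≤n) (ℕP.+-monoʳ-≤ a j≤n∸a)))
    switchedOff : ∀ j → n ∸ a < j → j ≤ n → (if does (a +ℕ j ≤? n) then g j else 0ℚ) ≡ 0ℚ
    switchedOff j n∸a<j _ = cong (if_then g j else 0ℚ) (dec-false (a +ℕ j ≤? n)
      (λ a+j≤n → ℕP.<⇒≱ n∸a<j (subst (_≤ n ∸ a) (ℕP.m+n∸m≡n a j) (ℕP.∸-monoˡ-≤ a a+j≤n))))

  sumTo-triangle : ∀ n (F : ℕ → ℕ → ℚ) →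
    sumTo (λ i → sumTo (F i) (n ∸ i)) n ≡ sumTo (λ j → sumTo (λ i → F i j) (n ∸ j)) n
  sumTo-triangle n F = begin
    sumTo (λ i → sumTo (F i) (n ∸ i)) n          ≡⟨ sumTo-cong n (λ i i≤n → sumTo-∸ i n (F i) i≤n) ⟩
    sumTo (λ i → sumTo (square i) n) n           ≡⟨ sumTo-comm n n square ⟩
    sumTo (λ j → sumTo (λ i → square i j) n) n   ≡⟨ sumTo-cong n (λ j j≤n → sym (trans (sumTo-∸ j n (λ i → F i j) j≤n)
                                                      (sumTo-cong n (λ i _ → cong (restrict i j) (ℕP.+-comm j i))))) ⟩
    sumTo (λ j → sumTo (λ i → F i j) (n ∸ j)) n  ∎
    where
    restrict : ℕ → ℕ → ℕ → ℚ
    restrict i j s = if does (s ≤? n) then F i j else 0ℚ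
    square : ℕ → ℕ → ℚ
    square i j = restrict i j (i +ℕ j)

  -- The Euler operator x·d/dx.
  θ : Series → Series
  θ f n = fromℕ n * f n

  θ-zeroˡ : ∀ f x → θ f 0 * x ≡ 0ℚ
  θ-zeroˡ f x = trans (cong (_* x) (ℚP.*-zeroˡ (f 0))) (ℚP.*-zeroˡ x)

  ⊛-leftComm : ∀ (f g h : Series) n → (f ⊛ (g ⊛ h)) n ≡ (g ⊛ (f ⊛ h)) n
  ⊛-leftComm f g h n = begin
    sumTo (λ i → f i * sumTo (λ j → g j * h (n ∸ i ∸ j)) (n ∸ i)) n
      ≡⟨ sumTo-cong n (λ i _ → sym (sumTo-*ˡ (n ∸ i) (f i) _)) ⟩
    sumTo (λ i → sumTo (λ j → f i * (g j * h (n ∸ i ∸ j))) (n ∸ i)) n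
      ≡⟨ sumTo-triangle n (λ i j → f i * (g j * h (n ∸ i ∸ j))) ⟩
    sumTo (λ j → sumTo (λ i → f i * (g j * h (n ∸ i ∸ j))) (n ∸ j)) n
      ≡⟨ sumTo-cong n (λ j _ → sumTo-cong (n ∸ j) (λ i _ → exchange i j)) ⟩
    sumTo (λ j → sumTo (λ i → g j * (f i * h (n ∸ j ∸ i))) (n ∸ j)) n
      ≡⟨ sumTo-cong n (λ j _ → sumTo-*ˡ (n ∸ j) (g j) _) ⟩
    sumTo (λ j → g j * sumTo (λ i → f i * h (n ∸ j ∸ i)) (n ∸ j)) n
      ∎
    where
    exchange : ∀ i j → f i * (g j * h (n ∸ i ∸ j)) ≡ g j * (f i * h (n ∸ j ∸ i))
    exchange i j rewrite ℕP.∸-+-assoc n i j | ℕP.∸-+-assoc n j i | ℕP.+-comm i j =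
      solve 3 (λ a b c → a :* (b :* c) := b :* (a :* c)) refl (f i) (g j) (h (n ∸ (j +ℕ i)))

  θ-⊛ : ∀ (f g : Series) n → θ (f ⊛ g) n ≡ (θ f ⊛ g) n + (f ⊛ θ g) n
  θ-⊛ f g n = begin
    fromℕ n * sumTo (λ i → f i * g (n ∸ i)) n                                  ≡⟨ sumTo-*ˡ n (fromℕ n) _ ⟨
    sumTo (λ i → fromℕ n * (f i * g (n ∸ i))) n                                ≡⟨ sumTo-cong n leibniz ⟩
    sumTo (λ i → θ f i * g (n ∸ i) + f i * θ g (n ∸ i)) n                      ≡⟨ sumTo-+ n _ _ ⟩
    (θ f ⊛ g) n + (f ⊛ θ g) n                                                  ∎
    where
    leibniz : ∀ i → i ≤ n → fromℕ n * (f i * g (n ∸ i)) ≡ θ f i * g (n ∸ i) + f i * θ g (n ∸ i)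
    leibniz i i≤n = begin
      fromℕ n * (f i * g (n ∸ i))                      ≡⟨ cong (λ m → fromℕ m * (f i * g (n ∸ i))) (ℕP.m+[n∸m]≡n i≤n) ⟨
      fromℕ (i +ℕ (n ∸ i)) * (f i * g (n ∸ i))         ≡⟨ cong (_* (f i * g (n ∸ i))) (fromℕ-+ i (n ∸ i)) ⟩
      (fromℕ i + fromℕ (n ∸ i)) * (f i * g (n ∸ i))    ≡⟨ solve 4 (λ a b x y → (a :+ b) :* (x :* y)
                                                                             := (a :* x) :* y :+ x :* (b :* y))
                                                             refl (fromℕ i) (fromℕ (n ∸ i)) (f i) (g (n ∸ i)) ⟩
      θ f i * g (n ∸ i) + f i * θ g (n ∸ i)            ∎

  ^ˢ-vanish : ∀ (f : Series) → f 0 ≡ 0ℚ → ∀ m n → n < m → (f ^ˢ m) n ≡ 0ℚ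
  ^ˢ-vanish f f0≡0 (suc m) n (s≤s n≤m) = sumTo-zero n term≡0
    where
    term≡0 : ∀ i → i ≤ n → f i * (f ^ˢ m) (n ∸ i) ≡ 0ℚ
    term≡0 zero    _    = trans (cong (_* (f ^ˢ m) n) f0≡0) (ℚP.*-zeroˡ ((f ^ˢ m) n))
    term≡0 (suc i) i<n = trans (cong (f (suc i) *_) (^ˢ-vanish f f0≡0 m (n ∸ suc i)
      (ℕP.<-≤-trans (ℕP.∸-monoʳ-< {n} {suc i} {0} (s≤s z≤n) i<n) n≤m))) (ℚP.*-zeroʳ (f (suc i)))

  θ-^ˢ-zero : ∀ (f : Series) n → θ (f ^ˢ 0) n ≡ 0ℚ
  θ-^ˢ-zero f zero    = refl
  θ-^ˢ-zero f (suc n) = ℚP.*-zeroʳ (fromℕ (suc n))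

  θ-^ˢ : ∀ (f : Series) m n → θ (f ^ˢ suc m) n ≡ fromℕ (suc m) * (θ f ⊛ (f ^ˢ m)) n
  θ-^ˢ f zero n = begin
    θ (f ⊛ (f ^ˢ 0)) n                              ≡⟨ θ-⊛ f (f ^ˢ 0) n ⟩
    (θ f ⊛ (f ^ˢ 0)) n + (f ⊛ θ (f ^ˢ 0)) n         ≡⟨ cong (_+_ ((θ f ⊛ (f ^ˢ 0)) n)) (sumTo-zero n (λ i _ →
                                                       trans (cong (f i *_) (θ-^ˢ-zero f (n ∸ i))) (ℚP.*-zeroʳ (f i)))) ⟩
    (θ f ⊛ (f ^ˢ 0)) n + 0ℚ                         ≡⟨ ℚP.+-identityʳ _ ⟩
    (θ f ⊛ (f ^ˢ 0)) n                              ≡⟨ ℚP.*-identityˡ _ ⟨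
    1ℚ * (θ f ⊛ (f ^ˢ 0)) n                         ∎
  θ-^ˢ f (suc m) n = begin
    θ (f ⊛ (f ^ˢ suc m)) n                          ≡⟨ θ-⊛ f (f ^ˢ suc m) n ⟩
    X + (f ⊛ θ (f ^ˢ suc m)) n                    ≡⟨ cong (_+_ X) inner ⟩
    X + c * X                                     ≡⟨ solve 2 (λ x c → x :+ c :* x := (con 1ℚ :+ c) :* x) refl X c ⟩
    (1ℚ + c) * X                                  ≡⟨ cong (_* X) (fromℕ-+ 1 (suc m)) ⟨
    fromℕ (suc (suc m)) * X                       ∎
    where
    c = fromℕ (suc m)
    X = (θ f ⊛ (f ^ˢ suc m)) n
    inner : (f ⊛ θ (f ^ˢ suc m)) n ≡ c * X
    inner = begin
      sumTo (λ i → f i * θ (f ^ˢ suc m) (n ∸ i)) n   ≡⟨ sumTo-cong n (λ i _ → trans (cong (f i *_) (θ-^ˢ f m (n ∸ i)))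
                                                         (solve 3 (λ a b d → a :* (b :* d) := b :* (a :* d)) refl (f i) c _)) ⟩
      sumTo (λ i → c * (f i * (θ f ⊛ (f ^ˢ m)) (n ∸ i))) n ≡⟨ sumTo-*ˡ n c _ ⟩
      c * (f ⊛ (θ f ⊛ (f ^ˢ m))) n                     ≡⟨ cong (c *_) (⊛-leftComm f (θ f) (f ^ˢ m) n) ⟩
      c * X                                          ∎

  fromℕ-*-/fact : ∀ m → fromℕ (suc m) * ((+ 1) /fact suc m) ≡ (+ 1) /fact m
  fromℕ-*-/fact m = begin
    a * u                           ≡⟨ ℚP.*-identityˡ (a * u) ⟨
    1ℚ * (a * u)                    ≡⟨ cong (_* (a * u)) (trans (ℚP.*-comm v F) (fromℕ-*-inverse (m !) {{m !≢0}})) ⟨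
    (v * F) * (a * u)               ≡⟨ solve 4 (λ v F a u → (v :* F) :* (a :* u) := v :* ((a :* F) :* u)) refl v F a u ⟩
    v * ((a * F) * u)               ≡⟨ cong (λ x → v * (x * u)) (fromℕ-* (suc m) (m !)) ⟨
    v * (fromℕ (suc m !) * u)       ≡⟨ cong (v *_) (fromℕ-*-inverse (suc m !) {{suc m !≢0}}) ⟩
    v * 1ℚ                          ≡⟨ ℚP.*-identityʳ v ⟩
    v                               ∎
    where
    a = fromℕ (suc m)
    F = fromℕ (m !)
    u = (+ 1) /fact suc m
    v = (+ 1) /fact m

  θ-expS-termwise : ∀ (f : Series) n →
    θ (expS f) (suc n) ≡ sumTo (λ m → (θ f ⊛ (f ^ˢ m)) (suc n) * ((+ 1) /fact m)) n
  θ-expS-termwise f n = begin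
    fromℕ (suc n) * sumTo (λ m → P m (suc n) * u m) (suc n)
      ≡⟨ sumTo-*ˡ (suc n) (fromℕ (suc n)) _ ⟨
    sumTo (λ m → fromℕ (suc n) * (P m (suc n) * u m)) (suc n)
      ≡⟨ sumTo-cong (suc n) (λ m _ → sym (ℚP.*-assoc (fromℕ (suc n)) (P m (suc n)) (u m))) ⟩
    sumTo (λ m → θ (P m) (suc n) * u m) (suc n)
      ≡⟨ sumTo-head n _ ⟩
    θ (P 0) (suc n) * u 0 + sumTo (λ m → θ (P (suc m)) (suc n) * u (suc m)) n
      ≡⟨ cong₂ _+_ (trans (cong (_* u 0) (θ-^ˢ-zero f (suc n))) (ℚP.*-zeroˡ (u 0)))
                   (sumTo-cong n (λ m _ → lowerPower m)) ⟩
    0ℚ + sumTo (λ m → (θ f ⊛ P m) (suc n) * u m) n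
      ≡⟨ ℚP.+-identityˡ _ ⟩
    sumTo (λ m → (θ f ⊛ P m) (suc n) * u m) n
      ∎
    where
    P : ℕ → Series
    P m = f ^ˢ m
    u : ℕ → ℚ
    u m = (+ 1) /fact m
    lowerPower : ∀ m → θ (P (suc m)) (suc n) * u (suc m) ≡ (θ f ⊛ P m) (suc n) * u m
    lowerPower m = begin
      θ (P (suc m)) (suc n) * u (suc m)                  ≡⟨ cong (_* u (suc m)) (θ-^ˢ f m (suc n)) ⟩
      fromℕ (suc m) * X * u (suc m)                      ≡⟨ solve 3 (λ a x b → a :* x :* b := x :* (a :* b))
                                                              refl (fromℕ (suc m)) X (u (suc m)) ⟩
      X * (fromℕ (suc m) * u (suc m))                    ≡⟨ cong (X *_) (fromℕ-*-/fact m) ⟩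
      X * u m                                            ∎
      where X = (θ f ⊛ P m) (suc n)

  θ-expS : ∀ (f : Series) → f 0 ≡ 0ℚ → ∀ n → θ (expS f) n ≡ (θ f ⊛ expS f) n
  θ-expS f f0≡0 zero = trans (ℚP.*-zeroˡ (expS f 0)) (sym (θ-zeroˡ f (expS f 0)))
  θ-expS f f0≡0 n@(suc n-1) = begin
    θ (expS f) n
      ≡⟨ θ-expS-termwise f n-1 ⟩
    sumTo (λ m → (θ f ⊛ P m) n * u m) n-1
      ≡⟨ sumTo-cong n-1 (λ m _ → sym (sumTo-*ʳ n (u m) _)) ⟩
    sumTo (λ m → sumTo (λ i → θ f i * P m (n ∸ i) * u m) n) n-1
      ≡⟨ sumTo-comm n-1 n _ ⟩
    sumTo (λ i → sumTo (λ m → θ f i * P m (n ∸ i) * u m) n-1) n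
      ≡⟨ sumTo-cong n (λ i _ → trans (sumTo-cong n-1 (λ m _ → ℚP.*-assoc (θ f i) _ (u m))) (sumTo-*ˡ n-1 (θ f i) _)) ⟩
    sumTo (λ i → θ f i * sumTo (λ m → P m (n ∸ i) * u m) n-1) n
      ≡⟨ sumTo-cong n (λ i _ → truncateExp i) ⟩
    sumTo (λ i → θ f i * expS f (n ∸ i)) n
      ∎
    where
    P : ℕ → Series
    P m = f ^ˢ m
    u : ℕ → ℚ
    u m = (+ 1) /fact m
    -- The i = 0 term is killed by θ f 0 = 0; otherwise n ∸ i ≤ n-1 and higher powers vanish.
    truncateExp : ∀ i → θ f i * sumTo (λ m → P m (n ∸ i) * u m) n-1 ≡ θ f i * expS f (n ∸ i)
    truncateExp zero    = trans (θ-zeroˡ f _) (sym (θ-zeroˡ f _))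
    truncateExp (suc i) = cong (θ f (suc i) *_) (sumTo-truncate n-1 _ (ℕP.m∸n≤m n-1 i)
      (λ m n-1∸i<m _ → trans (cong (_* u m) (^ˢ-vanish f f0≡0 m (n-1 ∸ i) n-1∸i<m)) (ℚP.*-zeroˡ (u m))))

  θ-logSeries : ∀ k q → θ (logSeries k) (suc q) ≡ fromℕ ⟦ q ℕ.<ᵇ k ⟧
  θ-logSeries k q with suc q ≤? k
  ... | yes q<k = trans (fromℕ-*-inverse (suc q)) (cong (fromℕ ∘ ⟦_⟧) (sym (dec-true (suc q ≤? k) q<k)))
  ... | no  q≮k = trans (ℚP.*-zeroʳ (fromℕ (suc q))) (cong (fromℕ ∘ ⟦_⟧) (sym (dec-false (suc q ≤? k) q≮k)))

  expS-logSeries-rec : ∀ k m → fromℕ (suc m) * expS (logSeries k) (suc m)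
                              ≡ sumTo (λ p → fromℕ ⟦ m ∸ p ℕ.<ᵇ k ⟧ * expS (logSeries k) p) m
  expS-logSeries-rec k m = begin
    fromℕ (suc m) * E (suc m)                                  ≡⟨ θ-expS L refl (suc m) ⟩
    (θ L ⊛ E) (suc m)                                          ≡⟨ sumTo-head m _ ⟩
    θ L 0 * E (suc m) + sumTo (λ i → θ L (suc i) * E (m ∸ i)) m
      ≡⟨ cong₂ _+_ (θ-zeroˡ L (E (suc m)))
                   (sumTo-cong m (λ i _ → cong (_* E (m ∸ i)) (θ-logSeries k i))) ⟩
    0ℚ + sumTo (λ i → fromℕ ⟦ i ℕ.<ᵇ k ⟧ * E (m ∸ i)) m         ≡⟨ ℚP.+-identityˡ _ ⟩
    sumTo (λ i → fromℕ ⟦ i ℕ.<ᵇ k ⟧ * E (m ∸ i)) m              ≡⟨ sumTo-reverse m _ ⟩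
    sumTo (λ p → fromℕ ⟦ m ∸ p ℕ.<ᵇ k ⟧ * E (m ∸ (m ∸ p))) m
      ≡⟨ sumTo-cong m (λ p p≤m → cong (λ q → fromℕ ⟦ m ∸ p ℕ.<ᵇ k ⟧ * E q) (ℕP.m∸[m∸n]≡n p≤m)) ⟩
    sumTo (λ p → fromℕ ⟦ m ∸ p ℕ.<ᵇ k ⟧ * E p) m                ∎
    where
    L = logSeries k
    E = expS (logSeries k)

-- Words over a finite alphabet

module _ where
  open import Data.Nat using (_+_; _*_; _∸_)
  open import Algebra.Properties.Semiring.Sum ℕP.+-*-semiring
    using (sum; sum-syntax; sum-cong-≗; ∑-distrib-+; ∑-comm; *-distribˡ-sum; sum-replicate-zero)
  open import Algebra.Properties.CommutativeSemigroup ℕP.+-commutativeSemigroup using (x∙yz≈y∙xz)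
  open ≡-Reasoning

  sumWords : (N m : ℕ) → (List (Fin N) → ℕ) → ℕ
  sumWords N zero    w = w []
  sumWords N (suc m) w = ∑[ x < N ] sumWords N m (λ l → w (x ∷ l))

  sumSplits : ℕ → (ℕ → ℕ → ℕ) → ℕ
  sumSplits m g = ∑[ p < m ] g (toℕ p) (m ∸ suc (toℕ p))

  sumWords-cong : ∀ N m {v w : List (Fin N) → ℕ} → (∀ l → length l ≡ m → v l ≡ w l) →
                  sumWords N m v ≡ sumWords N m w
  sumWords-cong N zero    v≗w = v≗w [] refl
  sumWords-cong N (suc m) v≗w = sum-cong-≗ (λ x → sumWords-cong N m (λ l |l|≡m → v≗w (x ∷ l) (cong suc |l|≡m)))

  sumWords-*ˡ : ∀ N m c (w : List (Fin N) → ℕ) → sumWords N m (λ l → c * w l) ≡ c * sumWords N m w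
  sumWords-*ˡ N zero    c w = refl
  sumWords-*ˡ N (suc m) c w = trans (sum-cong-≗ (λ x → sumWords-*ˡ N m c (λ l → w (x ∷ l))))
    (sym (*-distribˡ-sum c (λ x → sumWords N m (λ l → w (x ∷ l)))))

  sumWords-zero : ∀ N m {w : List (Fin N) → ℕ} → (∀ l → w l ≡ 0) → sumWords N m w ≡ 0
  sumWords-zero N zero    w≡0 = w≡0 []
  sumWords-zero N (suc m) w≡0 = trans (sum-cong-≗ (λ x → sumWords-zero N m (λ l → w≡0 (x ∷ l)))) (sum-replicate-zero N)

  sumSplits-cong : ∀ m {g h : ℕ → ℕ → ℕ} → (∀ p q → g p q ≡ h p q) → sumSplits m g ≡ sumSplits m h
  sumSplits-cong m {g} {h} g≗h =
    sum-cong-≗ {m} {λ p → g (toℕ p) (m ∸ suc (toℕ p))} {λ p → h (toℕ p) (m ∸ suc (toℕ p))} (λ p → g≗h (toℕ p) _)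

  sumSplits-zero : ∀ m {g : ℕ → ℕ → ℕ} → (∀ p q → g p q ≡ 0) → sumSplits m g ≡ 0
  sumSplits-zero m g≡0 = trans (sumSplits-cong m g≡0) (sum-replicate-zero m)

  sumWords-splitAtZero : ∀ N m (w : List (Fin (suc N)) → ℕ) →
    sumWords (suc N) m w ≡ sumWords N m (λ l → w (map Fin.suc l))
      + sumSplits m (λ p q → sumWords N p (λ σ → sumWords (suc N) q (λ τ → w (map Fin.suc σ ++ Fin.zero ∷ τ))))
  sumWords-splitAtZero N zero    w = sym (ℕP.+-identityʳ (w []))
  sumWords-splitAtZero N (suc m) w = begin
    A + ∑[ x < N ] sumWords (suc N) m (λ l → w (Fin.suc x ∷ l))
      ≡⟨ cong (A +_) (sum-cong-≗ (λ x → sumWords-splitAtZero N m (λ l → w (Fin.suc x ∷ l)))) ⟩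
    A + ∑[ x < N ] (B x + sumSplits m (C x))
      ≡⟨ cong (A +_) (∑-distrib-+ B (λ x → sumSplits m (C x))) ⟩
    A + (∑[ x < N ] B x + ∑[ x < N ] sumSplits m (C x))
      ≡⟨ cong (λ c → A + (∑[ x < N ] B x + c)) (∑-comm {N} {m} (λ x p → C x (toℕ p) (m ∸ suc (toℕ p)))) ⟩
    A + (∑[ x < N ] B x + sumSplits m (λ p q → ∑[ x < N ] C x p q))
      ≡⟨ x∙yz≈y∙xz A (∑[ x < N ] B x) _ ⟩
    ∑[ x < N ] B x + (A + sumSplits m (λ p q → ∑[ x < N ] C x p q))
      ∎
    where
    A = sumWords (suc N) m (λ l → w (Fin.zero ∷ l))
    B : Fin N → ℕ
    B x = sumWords N m (λ l → w (Fin.suc x ∷ map Fin.suc l))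
    C : Fin N → ℕ → ℕ → ℕ
    C x p q = sumWords N p (λ σ → sumWords (suc N) q (λ τ → w (Fin.suc x ∷ (map Fin.suc σ ++ Fin.zero ∷ τ))))

module _ where
  open import Data.Nat using (_+_; _*_; _∸_)
  open import Data.Bool using (_∧_; _∨_; not)
  import Data.Bool.Properties as BoolP
  open import Data.List using (_ʳ++_)
  open import Relation.Nullary using (does)
  open import Relation.Nullary.Decidable using (dec-true)
  open import Algebra.Properties.Semiring.Sum ℕP.+-*-semiring
    using (sum; sum-syntax; sum-cong-≗; ∑-distrib-+; *-distribˡ-sum; sum-replicate-zero)
  open ≡-Reasoning

  infix 7 _∈ᵇ_

  _∈ᵇ_ : ∀ {N} → Fin N → List (Fin N) → Bool
  x ∈ᵇ []      = false
  x ∈ᵇ (y ∷ U) = does (x Fin.≟ y) ∨ x ∈ᵇ U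

  distinct : ∀ {N} → List (Fin N) → Bool
  distinct []      = true
  distinct (x ∷ U) = not (x ∈ᵇ U) ∧ distinct U

  noRepeatsAfter : ∀ {N} → List (Fin N) → List (Fin N) → Bool
  noRepeatsAfter U []      = true
  noRepeatsAfter U (x ∷ l) = not (x ∈ᵇ U) ∧ noRepeatsAfter (x ∷ U) l

  ∈ᵇ-map-suc : ∀ {N} (x : Fin N) U → Fin.suc x ∈ᵇ map Fin.suc U ≡ x ∈ᵇ U
  ∈ᵇ-map-suc x []      = refl
  ∈ᵇ-map-suc x (y ∷ U) = cong (does (x Fin.≟ y) ∨_) (∈ᵇ-map-suc x U)

  zero-∈ᵇ-map-suc : ∀ {N} (U : List (Fin N)) → Fin.zero ∈ᵇ map Fin.suc U ≡ false
  zero-∈ᵇ-map-suc []      = refl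
  zero-∈ᵇ-map-suc (y ∷ U) = zero-∈ᵇ-map-suc U

  noRepeatsAfter-map-suc : ∀ {N} (U l : List (Fin N)) →
    noRepeatsAfter (map Fin.suc U) (map Fin.suc l) ≡ noRepeatsAfter U l
  noRepeatsAfter-map-suc U []      = refl
  noRepeatsAfter-map-suc U (x ∷ l) = cong₂ _∧_ (cong not (∈ᵇ-map-suc x U)) (noRepeatsAfter-map-suc (x ∷ U) l)

  noRepeatsAfter-cong-suc : ∀ {N} {U V : List (Fin (suc N))} → (∀ y → Fin.suc y ∈ᵇ U ≡ Fin.suc y ∈ᵇ V) →
    ∀ l → noRepeatsAfter U (map Fin.suc l) ≡ noRepeatsAfter V (map Fin.suc l)
  noRepeatsAfter-cong-suc U≈V []      = refl
  noRepeatsAfter-cong-suc U≈V (x ∷ l) =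
    cong₂ _∧_ (cong not (U≈V x)) (noRepeatsAfter-cong-suc (λ y → cong (does (y Fin.≟ x) ∨_) (U≈V y)) l)

  noRepeatsAfter-zero∷ : ∀ {N} (W τ : List (Fin N)) →
    noRepeatsAfter (map Fin.suc W) (Fin.zero ∷ map Fin.suc τ) ≡ noRepeatsAfter W τ
  noRepeatsAfter-zero∷ W τ = begin
    not (Fin.zero ∈ᵇ map Fin.suc W) ∧ noRepeatsAfter (Fin.zero ∷ map Fin.suc W) (map Fin.suc τ)
      ≡⟨ cong₂ _∧_ (cong not (zero-∈ᵇ-map-suc W)) (noRepeatsAfter-cong-suc (λ _ → refl) τ) ⟩
    noRepeatsAfter (map Fin.suc W) (map Fin.suc τ)
      ≡⟨ noRepeatsAfter-map-suc W τ ⟩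
    noRepeatsAfter W τ
      ∎

  noRepeatsAfter-++ : ∀ {N} (U a b : List (Fin N)) →
    noRepeatsAfter U (a ++ b) ≡ noRepeatsAfter U a ∧ noRepeatsAfter (a ʳ++ U) b
  noRepeatsAfter-++ U []      b = refl
  noRepeatsAfter-++ U (x ∷ a) b =
    trans (cong (not (x ∈ᵇ U) ∧_) (noRepeatsAfter-++ (x ∷ U) a b)) (sym (BoolP.∧-assoc (not (x ∈ᵇ U)) _ _))

  noRepeatsAfter⇒distinct : ∀ {N} (U σ : List (Fin N)) →
    noRepeatsAfter U σ ≡ true → distinct U ≡ true → distinct (σ ʳ++ U) ≡ true
  noRepeatsAfter⇒distinct U []      _  dU = dU
  noRepeatsAfter⇒distinct U (x ∷ σ) nr dU with x ∈ᵇ U in x∈U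
  ... | false = noRepeatsAfter⇒distinct (x ∷ U) σ nr (trans (cong (λ b → not b ∧ distinct U) x∈U) dU)

  noRepeatsAfter-∈ : ∀ {N} x (U b c : List (Fin N)) → x ∈ᵇ U ≡ true → noRepeatsAfter U (b ++ x ∷ c) ≡ false
  noRepeatsAfter-∈ x U []      c x∈U = cong (λ b → not b ∧ noRepeatsAfter (x ∷ U) c) x∈U
  noRepeatsAfter-∈ x U (y ∷ b) c x∈U = trans (cong (not (y ∈ᵇ U) ∧_)
    (noRepeatsAfter-∈ x (y ∷ U) b c (trans (cong (does (x Fin.≟ y) ∨_) x∈U) (BoolP.∨-zeroʳ _))))
    (BoolP.∧-zeroʳ _)

  noRepeatsAfter-repeat : ∀ {N} x (U a b c : List (Fin N)) → noRepeatsAfter U (a ++ x ∷ b ++ x ∷ c) ≡ false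
  noRepeatsAfter-repeat x U []      b c = trans (cong (not (x ∈ᵇ U) ∧_)
    (noRepeatsAfter-∈ x (x ∷ U) b c (cong (_∨ x ∈ᵇ U) (dec-true (x Fin.≟ x) refl))))
    (BoolP.∧-zeroʳ _)
  noRepeatsAfter-repeat x U (y ∷ a) b c =
    trans (cong (not (y ∈ᵇ U) ∧_) (noRepeatsAfter-repeat x (y ∷ U) a b c)) (BoolP.∧-zeroʳ _)

  ∑-one : ∀ N → ∑[ x < N ] 1 ≡ N
  ∑-one zero    = refl
  ∑-one (suc N) = cong suc (∑-one N)

  ∑-≟ : ∀ {N} (y : Fin N) → ∑[ x < N ] ⟦ does (x Fin.≟ y) ⟧ ≡ 1
  ∑-≟ {suc N} Fin.zero    = cong suc (sum-replicate-zero N)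
  ∑-≟         (Fin.suc y) = ∑-≟ y

  ∑-∈ᵇ : ∀ {N} (W : List (Fin N)) → distinct W ≡ true → ∑[ x < N ] ⟦ x ∈ᵇ W ⟧ ≡ length W
  ∑-∈ᵇ {N} []      _  = sum-replicate-zero N
  ∑-∈ᵇ {N} (y ∷ W) dW with y ∈ᵇ W in y∈W
  ... | false = trans (sum-cong-≗ split)
    (trans (∑-distrib-+ (λ x → ⟦ does (x Fin.≟ y) ⟧) (λ x → ⟦ x ∈ᵇ W ⟧)) (cong₂ _+_ (∑-≟ y) (∑-∈ᵇ W dW)))
    where
    split : ∀ x → ⟦ does (x Fin.≟ y) ∨ x ∈ᵇ W ⟧ ≡ ⟦ does (x Fin.≟ y) ⟧ + ⟦ x ∈ᵇ W ⟧
    split x with x Fin.≟ y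
    ... | yes refl = sym (cong (λ b → suc ⟦ b ⟧) y∈W)
    ... | no  _    = refl

  ∑-∉ᵇ : ∀ {N} (W : List (Fin N)) → distinct W ≡ true → ∑[ x < N ] ⟦ not (x ∈ᵇ W) ⟧ ≡ N ∸ length W
  ∑-∉ᵇ {N} W dW = begin
    S                                          ≡⟨ ℕP.m+n∸n≡m S (length W) ⟨
    S + length W ∸ length W                    ≡⟨ cong (λ t → S + t ∸ length W) (∑-∈ᵇ W dW) ⟨
    S + ∑[ x < N ] ⟦ x ∈ᵇ W ⟧ ∸ length W       ≡⟨ cong (_∸ length W) total ⟩
    N ∸ length W                               ∎
    where
    S = ∑[ x < N ] ⟦ not (x ∈ᵇ W) ⟧
    complement : ∀ b → ⟦ not b ⟧ + ⟦ b ⟧ ≡ 1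
    complement true  = refl
    complement false = refl
    total : S + ∑[ x < N ] ⟦ x ∈ᵇ W ⟧ ≡ N
    total = trans (sym (∑-distrib-+ (λ x → ⟦ not (x ∈ᵇ W) ⟧) (λ x → ⟦ x ∈ᵇ W ⟧)))
      (trans (sum-cong-≗ (λ x → complement (x ∈ᵇ W))) (∑-one N))

  sumWords-noRepeatsAfter : ∀ N q (W : List (Fin N)) → distinct W ≡ true →
    sumWords N q (λ τ → ⟦ noRepeatsAfter W τ ⟧) ≡ (N ∸ length W) ↓ q
  sumWords-noRepeatsAfter N zero    W dW = refl
  sumWords-noRepeatsAfter N (suc q) W dW = begin
    ∑[ x < N ] sumWords N q (λ τ → ⟦ not (x ∈ᵇ W) ∧ noRepeatsAfter (x ∷ W) τ ⟧)
      ≡⟨ sum-cong-≗ firstLetter ⟩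
    ∑[ x < N ] (c * ⟦ not (x ∈ᵇ W) ⟧)
      ≡⟨ *-distribˡ-sum c (λ x → ⟦ not (x ∈ᵇ W) ⟧) ⟨
    c * ∑[ x < N ] ⟦ not (x ∈ᵇ W) ⟧
      ≡⟨ cong (c *_) (∑-∉ᵇ W dW) ⟩
    c * (N ∸ length W)
      ≡⟨ ℕP.*-comm c (N ∸ length W) ⟩
    (N ∸ length W) * (N ∸ suc (length W)) ↓ q
      ≡⟨ cong (λ n → (N ∸ length W) * n ↓ q) (ℕP.pred[m∸n]≡m∸[1+n] N (length W)) ⟨
    (N ∸ length W) * pred (N ∸ length W) ↓ q
      ∎
    where
    c = (N ∸ suc (length W)) ↓ q
    firstLetter : ∀ x → sumWords N q (λ τ → ⟦ not (x ∈ᵇ W) ∧ noRepeatsAfter (x ∷ W) τ ⟧)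
                        ≡ c * ⟦ not (x ∈ᵇ W) ⟧
    firstLetter x with x ∈ᵇ W in x∈W
    ... | true  = trans (sumWords-zero N q (λ _ → refl)) (sym (ℕP.*-zeroʳ c))
    ... | false = trans (sumWords-noRepeatsAfter N q (x ∷ W) (trans (cong (λ b → not b ∧ distinct W) x∈W) dW))
                        (sym (ℕP.*-identityʳ c))

-- Avoiding the segmented pattern

module _ where
  open import Data.Nat using (_+_; _<ᵇ_)
  open import Data.Bool using (_∧_; not)
  import Data.Bool.Properties as BoolP

  startsOccurrence : ∀ {N} → ℕ → Fin N → List (Fin N) → Bool
  startsOccurrence zero    x ys       = true
  startsOccurrence (suc k) x []       = false
  startsOccurrence (suc k) x (y ∷ ys) = (toℕ x <ᵇ toℕ y) ∧ startsOccurrence k x ys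

  avoids : ∀ {N} → ℕ → List (Fin N) → Bool
  avoids k []       = true
  avoids k (x ∷ ys) = not (startsOccurrence k x ys) ∧ avoids k ys

  startsOccurrence-map-suc : ∀ {N} k (x : Fin N) ys →
    startsOccurrence k (Fin.suc x) (map Fin.suc ys) ≡ startsOccurrence k x ys
  startsOccurrence-map-suc zero    x ys       = refl
  startsOccurrence-map-suc (suc k) x []       = refl
  startsOccurrence-map-suc (suc k) x (y ∷ ys) = cong ((toℕ x <ᵇ toℕ y) ∧_) (startsOccurrence-map-suc k x ys)

  avoids-map-suc : ∀ {N} k (l : List (Fin N)) → avoids k (map Fin.suc l) ≡ avoids k l
  avoids-map-suc k []      = refl
  avoids-map-suc k (x ∷ l) = cong₂ _∧_ (cong not (startsOccurrence-map-suc k x l)) (avoids-map-suc k l)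

  startsOccurrence-short : ∀ {N} k (x : Fin N) ys → length ys < k → startsOccurrence k x ys ≡ false
  startsOccurrence-short (suc k) x []       _           = refl
  startsOccurrence-short (suc k) x (y ∷ ys) (s≤s |ys|<k) =
    trans (cong ((toℕ x <ᵇ toℕ y) ∧_) (startsOccurrence-short k x ys |ys|<k)) (BoolP.∧-zeroʳ _)

  avoids-short : ∀ {N} k (l : List (Fin N)) → length l < k → avoids k l ≡ true
  avoids-short k []       _      = refl
  avoids-short k (x ∷ ys) |l|<k = cong₂ _∧_ (cong not (startsOccurrence-short k x ys |ys|<k)) (avoids-short k ys |ys|<k)
    where |ys|<k = ℕP.<-trans (ℕP.n<1+n (length ys)) |l|<k

  startsOccurrence-before-zero : ∀ {N} k (x : Fin N) ys r →
    startsOccurrence k (Fin.suc x) (map Fin.suc ys ++ Fin.zero ∷ r) ≡ startsOccurrence k x ys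
  startsOccurrence-before-zero zero    x ys       r = refl
  startsOccurrence-before-zero (suc k) x []       r = refl
  startsOccurrence-before-zero (suc k) x (y ∷ ys) r = cong ((toℕ x <ᵇ toℕ y) ∧_) (startsOccurrence-before-zero k x ys r)

  startsOccurrence-zero : ∀ {N} k (t : List (Fin N)) →
    startsOccurrence k Fin.zero (map Fin.suc t) ≡ not (length t <ᵇ k)
  startsOccurrence-zero zero    t       = refl
  startsOccurrence-zero (suc k) []      = refl
  startsOccurrence-zero (suc k) (y ∷ t) = startsOccurrence-zero k t

  -- No occurrence can start in σ and run past the 0, and the 0 starts one iff k letters follow it.
  avoids-splitAtZero : ∀ {N} k (σ τ : List (Fin N)) →
    avoids k (map Fin.suc σ ++ Fin.zero ∷ map Fin.suc τ) ≡ avoids k σ ∧ (length τ <ᵇ k)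
  avoids-splitAtZero k [] τ =
    trans (cong₂ _∧_ (trans (cong not (startsOccurrence-zero k τ)) (BoolP.not-involutive _)) (avoids-map-suc k τ))
          (shortSuffix (length τ <ᵇ k) refl)
    where
    shortSuffix : ∀ b → (length τ <ᵇ k) ≡ b → b ∧ avoids k τ ≡ b
    shortSuffix false _     = refl
    shortSuffix true  |τ|<k = avoids-short k τ (ℕP.<ᵇ⇒< (length τ) k (Equivalence.from BoolP.T-≡ |τ|<k))
  avoids-splitAtZero k (x ∷ σ) τ =
    trans (cong₂ _∧_ (cong not (startsOccurrence-before-zero k x σ _)) (avoids-splitAtZero k σ τ))
          (sym (BoolP.∧-assoc (not (startsOccurrence k x σ)) _ _))

module _ where
  open import Data.Nat using (_+_; _*_; _∸_; _<ᵇ_)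
  open import Data.Bool using (_∧_)
  open import Data.List using (reverse)
  open ≡-Reasoning

  ⟦∧⟧ : ∀ a b → ⟦ a ∧ b ⟧ ≡ ⟦ a ⟧ * ⟦ b ⟧
  ⟦∧⟧ true  b = sym (ℕP.+-identityʳ ⟦ b ⟧)
  ⟦∧⟧ false b = refl

  weight : ∀ {N} → ℕ → List (Fin N) → ℕ
  weight k l = ⟦ noRepeatsAfter [] l ⟧ * ⟦ avoids k l ⟧

  avoiders : ℕ → ℕ → ℕ → ℕ
  avoiders k N m = sumWords N m (weight k)

  weight-map-suc : ∀ {N} k (l : List (Fin N)) → weight k (map Fin.suc l) ≡ weight k l
  weight-map-suc k l = cong₂ _*_ (cong ⟦_⟧ (noRepeatsAfter-map-suc [] l)) (cong ⟦_⟧ (avoids-map-suc k l))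

  weight-repeat : ∀ {N} k x (a b c : List (Fin N)) → weight k (a ++ x ∷ b ++ x ∷ c) ≡ 0
  weight-repeat k x a b c = cong (λ d → ⟦ d ⟧ * ⟦ avoids k (a ++ x ∷ b ++ x ∷ c) ⟧) (noRepeatsAfter-repeat x [] a b c)

  weight-splitAtZero : ∀ {N} k (σ τ : List (Fin N)) →
    weight k (map Fin.suc σ ++ Fin.zero ∷ map Fin.suc τ)
      ≡ ⟦ length τ <ᵇ k ⟧ * weight k σ * ⟦ noRepeatsAfter (reverse σ) τ ⟧
  weight-splitAtZero k σ τ = begin
    ⟦ noRepeatsAfter [] w ⟧ * ⟦ avoids k w ⟧
      ≡⟨ cong₂ (λ a b → ⟦ a ⟧ * ⟦ b ⟧) noRepeats (avoids-splitAtZero k σ τ) ⟩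
    ⟦ noRepeatsAfter [] σ ∧ noRepeatsAfter (reverse σ) τ ⟧ * ⟦ avoids k σ ∧ (length τ <ᵇ k) ⟧
      ≡⟨ cong₂ _*_ (⟦∧⟧ (noRepeatsAfter [] σ) _) (⟦∧⟧ (avoids k σ) _) ⟩
    ⟦ noRepeatsAfter [] σ ⟧ * ⟦ noRepeatsAfter (reverse σ) τ ⟧ * (⟦ avoids k σ ⟧ * ⟦ length τ <ᵇ k ⟧)
      ≡⟨ solve 4 (λ a b c d → a :* b :* (c :* d) := d :* (a :* c) :* b) refl
           ⟦ noRepeatsAfter [] σ ⟧ ⟦ noRepeatsAfter (reverse σ) τ ⟧ ⟦ avoids k σ ⟧ ⟦ length τ <ᵇ k ⟧ ⟩
    ⟦ length τ <ᵇ k ⟧ * weight k σ * ⟦ noRepeatsAfter (reverse σ) τ ⟧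
      ∎
    where
    open +-*-Solver using (solve; _:*_; _:=_)
    w = map Fin.suc σ ++ Fin.zero ∷ map Fin.suc τ
    noRepeats : noRepeatsAfter [] w ≡ noRepeatsAfter [] σ ∧ noRepeatsAfter (reverse σ) τ
    noRepeats = begin
      noRepeatsAfter [] w
        ≡⟨ noRepeatsAfter-++ [] (map Fin.suc σ) _ ⟩
      noRepeatsAfter [] (map Fin.suc σ) ∧ noRepeatsAfter (reverse (map Fin.suc σ)) (Fin.zero ∷ map Fin.suc τ)
        ≡⟨ cong₂ _∧_ (noRepeatsAfter-map-suc [] σ)
                     (cong (λ U → noRepeatsAfter U (Fin.zero ∷ map Fin.suc τ)) (sym (ListP.map-ʳ++ Fin.suc σ))) ⟩
      noRepeatsAfter [] σ ∧ noRepeatsAfter (map Fin.suc (reverse σ)) (Fin.zero ∷ map Fin.suc τ)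
        ≡⟨ cong (noRepeatsAfter [] σ ∧_) (noRepeatsAfter-zero∷ (reverse σ) τ) ⟩
      noRepeatsAfter [] σ ∧ noRepeatsAfter (reverse σ) τ
        ∎

  weight-*-extensions : ∀ {N} k (σ : List (Fin N)) q →
    weight k σ * sumWords N q (λ τ → ⟦ noRepeatsAfter (reverse σ) τ ⟧) ≡ weight k σ * (N ∸ length σ) ↓ q
  weight-*-extensions {N} k σ q with noRepeatsAfter [] σ in noRepeats
  ... | false = refl
  ... | true  = cong (⟦ true ⟧ * ⟦ avoids k σ ⟧ *_) (trans
    (sumWords-noRepeatsAfter N q (reverse σ) (noRepeatsAfter⇒distinct [] σ noRepeats refl))
    (cong (λ n → (N ∸ n) ↓ q) (ListP.length-reverse σ)))

  sumWords-afterZero : ∀ {N} k (σ : List (Fin N)) q →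
    sumWords (suc N) q (λ τ → weight k (map Fin.suc σ ++ Fin.zero ∷ τ))
      ≡ ⟦ q <ᵇ k ⟧ * ((N ∸ length σ) ↓ q * weight k σ)
  sumWords-afterZero {N} k σ q = begin
    sumWords (suc N) q (λ τ → weight k (σ′ ++ Fin.zero ∷ τ))
      ≡⟨ sumWords-splitAtZero N q _ ⟩
    sumWords N q (λ τ → weight k (σ′ ++ Fin.zero ∷ map Fin.suc τ)) + sumSplits q secondZero
      ≡⟨ cong (sumWords N q (λ τ → weight k (σ′ ++ Fin.zero ∷ map Fin.suc τ)) +_) (sumSplits-zero q (λ p r →
           sumWords-zero N p (λ ρ → sumWords-zero (suc N) r (λ τ → weight-repeat k Fin.zero σ′ (map Fin.suc ρ) τ)))) ⟩
    sumWords N q (λ τ → weight k (σ′ ++ Fin.zero ∷ map Fin.suc τ)) + 0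
      ≡⟨ ℕP.+-identityʳ _ ⟩
    sumWords N q (λ τ → weight k (σ′ ++ Fin.zero ∷ map Fin.suc τ))
      ≡⟨ sumWords-cong N q (λ τ |τ|≡q → trans (weight-splitAtZero k σ τ)
           (cong (λ n → ⟦ n <ᵇ k ⟧ * weight k σ * ⟦ noRepeatsAfter (reverse σ) τ ⟧) |τ|≡q)) ⟩
    sumWords N q (λ τ → ⟦ q <ᵇ k ⟧ * weight k σ * ⟦ noRepeatsAfter (reverse σ) τ ⟧)
      ≡⟨ sumWords-*ˡ N q (⟦ q <ᵇ k ⟧ * weight k σ) _ ⟩
    ⟦ q <ᵇ k ⟧ * weight k σ * sumWords N q (λ τ → ⟦ noRepeatsAfter (reverse σ) τ ⟧)
      ≡⟨ ℕP.*-assoc ⟦ q <ᵇ k ⟧ (weight k σ) _ ⟩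
    ⟦ q <ᵇ k ⟧ * (weight k σ * sumWords N q (λ τ → ⟦ noRepeatsAfter (reverse σ) τ ⟧))
      ≡⟨ cong (⟦ q <ᵇ k ⟧ *_) (trans (weight-*-extensions k σ q) (ℕP.*-comm (weight k σ) _)) ⟩
    ⟦ q <ᵇ k ⟧ * ((N ∸ length σ) ↓ q * weight k σ)
      ∎
    where
    σ′ = map Fin.suc σ
    secondZero : ℕ → ℕ → ℕ
    secondZero p r =
      sumWords N p (λ ρ → sumWords (suc N) r (λ τ → weight k (σ′ ++ Fin.zero ∷ map Fin.suc ρ ++ Fin.zero ∷ τ)))

  avoiders-rec : ∀ k N m →
    avoiders k (suc N) m ≡ avoiders k N m + sumSplits m (λ p q → ⟦ q <ᵇ k ⟧ * ((N ∸ p) ↓ q * avoiders k N p))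
  avoiders-rec k N m = trans (sumWords-splitAtZero N m (weight k))
    (cong₂ _+_ (sumWords-cong N m (λ l _ → weight-map-suc k l)) (sumSplits-cong m prefixes))
    where
    prefixes : ∀ p q → sumWords N p (λ σ → sumWords (suc N) q (λ τ → weight k (map Fin.suc σ ++ Fin.zero ∷ τ)))
                     ≡ ⟦ q <ᵇ k ⟧ * ((N ∸ p) ↓ q * avoiders k N p)
    prefixes p q = begin
      sumWords N p (λ σ → sumWords (suc N) q (λ τ → weight k (map Fin.suc σ ++ Fin.zero ∷ τ)))
        ≡⟨ sumWords-cong N p (λ σ |σ|≡p → trans (sumWords-afterZero k σ q)
             (cong (λ n → ⟦ q <ᵇ k ⟧ * ((N ∸ n) ↓ q * weight k σ)) |σ|≡p)) ⟩
      sumWords N p (λ σ → ⟦ q <ᵇ k ⟧ * ((N ∸ p) ↓ q * weight k σ))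
        ≡⟨ sumWords-*ˡ N p ⟦ q <ᵇ k ⟧ _ ⟩
      ⟦ q <ᵇ k ⟧ * sumWords N p (λ σ → (N ∸ p) ↓ q * weight k σ)
        ≡⟨ cong (⟦ q <ᵇ k ⟧ *_) (sumWords-*ˡ N p ((N ∸ p) ↓ q) (weight k)) ⟩
      ⟦ q <ᵇ k ⟧ * ((N ∸ p) ↓ q * avoiders k N p)
        ∎

module _ where
  open import Data.Rational using (_+_; _*_)
  open import Data.Nat using (_∸_; _<ᵇ_) renaming (_+_ to _+ℕ_; _*_ to _*ℕ_)
  open ℚSolver.+-*-Solver using (solve; _:+_; _:*_; _:=_)
  open ≡-Reasoning

  fromℕ-sumSplits : ∀ m (g : ℕ → ℕ → ℕ) → fromℕ (sumSplits (suc m) g) ≡ sumTo (λ p → fromℕ (g p (m ∸ p))) m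
  fromℕ-sumSplits zero    g = cong fromℕ (ℕP.+-identityʳ (g 0 0))
  fromℕ-sumSplits (suc m) g = begin
    fromℕ (g 0 (suc m) +ℕ sumSplits (suc m) (λ p q → g (suc p) q))
      ≡⟨ fromℕ-+ (g 0 (suc m)) _ ⟩
    fromℕ (g 0 (suc m)) + fromℕ (sumSplits (suc m) (λ p q → g (suc p) q))
      ≡⟨ cong (fromℕ (g 0 (suc m)) +_) (fromℕ-sumSplits m (λ p q → g (suc p) q)) ⟩
    fromℕ (g 0 (suc m)) + sumTo (λ p → fromℕ (g (suc p) (m ∸ p))) m
      ≡⟨ sumTo-head m (λ p → fromℕ (g p (suc m ∸ p))) ⟨
    sumTo (λ p → fromℕ (g p (suc m ∸ p))) (suc m)
      ∎

  fromℕ-↓-pascal : ∀ N m x →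
    fromℕ (N ↓ suc m) * x + fromℕ (N ↓ m) * (fromℕ (suc m) * x) ≡ fromℕ (suc N ↓ suc m) * x
  fromℕ-↓-pascal N m x = begin
    fromℕ (N ↓ suc m) * x + fromℕ (N ↓ m) * (fromℕ (suc m) * x)
      ≡⟨ solve 4 (λ a b c x → a :* x :+ b :* (c :* x) := (a :+ c :* b) :* x) refl
           (fromℕ (N ↓ suc m)) (fromℕ (N ↓ m)) (fromℕ (suc m)) x ⟩
    (fromℕ (N ↓ suc m) + fromℕ (suc m) * fromℕ (N ↓ m)) * x
      ≡⟨ cong (λ c → (fromℕ (N ↓ suc m) + c) * x) (fromℕ-* (suc m) (N ↓ m)) ⟨
    (fromℕ (N ↓ suc m) + fromℕ (suc m *ℕ N ↓ m)) * x
      ≡⟨ cong (_* x) (fromℕ-+ (N ↓ suc m) _) ⟨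
    fromℕ (N ↓ suc m +ℕ suc m *ℕ N ↓ m) * x
      ≡⟨ cong (λ c → fromℕ c * x) (↓-pascal N m) ⟩
    fromℕ (suc N ↓ suc m) * x
      ∎

  avoiders-closedForm : ∀ k N m → fromℕ (avoiders k N m) ≡ fromℕ (N ↓ m) * expS (logSeries k) m
  avoiders-closedForm k zero    zero    = refl
  avoiders-closedForm k (suc N) zero    = refl
  avoiders-closedForm k zero    (suc m) = sym (ℚP.*-zeroˡ (expS (logSeries k) (suc m)))
  avoiders-closedForm k (suc N) (suc m) = begin
    fromℕ (avoiders k (suc N) (suc m))
      ≡⟨ cong fromℕ (avoiders-rec k N (suc m)) ⟩
    fromℕ (avoiders k N (suc m) +ℕ sumSplits (suc m) g)
      ≡⟨ fromℕ-+ (avoiders k N (suc m)) _ ⟩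
    fromℕ (avoiders k N (suc m)) + fromℕ (sumSplits (suc m) g)
      ≡⟨ cong₂ _+_ (avoiders-closedForm k N (suc m)) (fromℕ-sumSplits m g) ⟩
    fromℕ (N ↓ suc m) * E (suc m) + sumTo (λ p → fromℕ (g p (m ∸ p))) m
      ≡⟨ cong (fromℕ (N ↓ suc m) * E (suc m) +_) (sumTo-cong m splitTerm) ⟩
    fromℕ (N ↓ suc m) * E (suc m) + sumTo (λ p → fromℕ (N ↓ m) * (fromℕ ⟦ m ∸ p <ᵇ k ⟧ * E p)) m
      ≡⟨ cong (fromℕ (N ↓ suc m) * E (suc m) +_) (trans (sumTo-*ˡ m (fromℕ (N ↓ m)) _)
           (cong (fromℕ (N ↓ m) *_) (sym (expS-logSeries-rec k m)))) ⟩
    fromℕ (N ↓ suc m) * E (suc m) + fromℕ (N ↓ m) * (fromℕ (suc m) * E (suc m))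
      ≡⟨ fromℕ-↓-pascal N m (E (suc m)) ⟩
    fromℕ (suc N ↓ suc m) * E (suc m)
      ∎
    where
    E = expS (logSeries k)
    g : ℕ → ℕ → ℕ
    g p q = ⟦ q <ᵇ k ⟧ *ℕ ((N ∸ p) ↓ q *ℕ avoiders k N p)
    splitTerm : ∀ p → p ≤ m → fromℕ (g p (m ∸ p)) ≡ fromℕ (N ↓ m) * (fromℕ ⟦ m ∸ p <ᵇ k ⟧ * E p)
    splitTerm p p≤m = begin
      fromℕ (⟦ b ⟧ *ℕ (F *ℕ avoiders k N p))
        ≡⟨ trans (fromℕ-* ⟦ b ⟧ _) (cong (fromℕ ⟦ b ⟧ *_) (fromℕ-* F _)) ⟩
      fromℕ ⟦ b ⟧ * (fromℕ F * fromℕ (avoiders k N p))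
        ≡⟨ cong (λ x → fromℕ ⟦ b ⟧ * (fromℕ F * x)) (avoiders-closedForm k N p) ⟩
      fromℕ ⟦ b ⟧ * (fromℕ F * (fromℕ (N ↓ p) * E p))
        ≡⟨ solve 4 (λ a x y e → a :* (x :* (y :* e)) := (y :* x) :* (a :* e)) refl
             (fromℕ ⟦ b ⟧) (fromℕ F) (fromℕ (N ↓ p)) (E p) ⟩
      (fromℕ (N ↓ p) * fromℕ F) * (fromℕ ⟦ b ⟧ * E p)
        ≡⟨ cong (_* (fromℕ ⟦ b ⟧ * E p)) (trans (sym (fromℕ-* (N ↓ p) F))
             (cong fromℕ (trans (sym (↓-+ N p (m ∸ p))) (cong (N ↓_) (ℕP.m+[n∸m]≡n p≤m))))) ⟩
      fromℕ (N ↓ m) * (fromℕ ⟦ b ⟧ * E p)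
        ∎
      where
      b = m ∸ p <ᵇ k
      F = (N ∸ p) ↓ (m ∸ p)

-- Dashed versus segmented occurrences

module _ where
  open import Data.Nat using (_+_; _∸_)
  open import Data.Product using (∃-syntax; _×_; _,_)
  open import Relation.Binary.Definitions using (tri<; tri≈; tri>)
  open import Data.Empty using (⊥-elim)

  SegmentedOccurrence : ℕ → ℕ → (ℕ → ℕ) → Set
  SegmentedOccurrence k n f = ∃[ i ] i + k < n × (∀ t → t < k → f i < f (i + suc t))

  DashedOccurrence : ℕ → ℕ → (ℕ → ℕ) → Set
  DashedOccurrence k n f = ∃[ i ] ∃[ j ] i < j × j + k ≤ n × (∀ t → t < k → f i < f (j + t))

  InjectiveBelow : ℕ → (ℕ → ℕ) → Set
  InjectiveBelow n f = ∀ {a b} → a < n → b < n → f a ≡ f b → a ≡ b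

  segmented⇒dashed : ∀ {k n f} → SegmentedOccurrence k n f → DashedOccurrence k n f
  segmented⇒dashed {f = f} (i , i+k<n , rises) =
    i , suc i , ℕP.n<1+n i , i+k<n , λ t t<k → subst (λ j → f i < f j) (ℕP.+-suc i t) (rises t t<k)

  -- Shrink the gap between the positions of a and a₁: the letter just before a₁ either exceeds
  -- f i, and joins the window, or is below it, and starts a segmented occurrence.
  dashed⇒segmented : ∀ {k n f} → InjectiveBelow n f → DashedOccurrence k n f → SegmentedOccurrence k n f
  dashed⇒segmented {k} {n} {f} inj (i , j , i<j , j+k≤n , above) =
    closeGap (j ∸ suc i) i (subst (λ j → j + k ≤ n) (sym gap) j+k≤n)
      (λ t t<k → subst (λ j → f i < f (j + t)) (sym gap) (above t t<k))
    where
    gap : suc (i + (j ∸ suc i)) ≡ j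
    gap = ℕP.m+[n∸m]≡n i<j
    shift : ∀ i d t → suc (i + suc d) + t ≡ suc (i + d) + suc t
    shift i d t = cong suc (trans (cong (_+ t) (ℕP.+-suc i d)) (sym (ℕP.+-suc (i + d) t)))
    closeGap : ∀ d i → suc (i + d) + k ≤ n → (∀ t → t < k → f i < f (suc (i + d) + t)) → SegmentedOccurrence k n f
    closeGap zero    i bound above = i , subst (λ x → suc x + k ≤ n) (ℕP.+-identityʳ i) bound ,
      λ t t<k → subst (λ x → f i < f x)
        (trans (cong (λ x → suc x + t) (ℕP.+-identityʳ i)) (sym (ℕP.+-suc i t))) (above t t<k)
    closeGap (suc d) i bound above with ℕP.<-cmp (f i) (f (suc (i + d)))
    ... | tri< fi<fl _ _ =
      closeGap d i (ℕP.≤-trans (s≤s (ℕP.+-monoˡ-≤ k (ℕP.+-monoʳ-≤ i (ℕP.n≤1+n d)))) bound) above′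
      where
      above′ : ∀ t → t < k → f i < f (suc (i + d) + t)
      above′ zero    _   = subst (λ x → f i < f x) (sym (ℕP.+-identityʳ _)) fi<fl
      above′ (suc t) t<k = subst (λ x → f i < f x) (shift i d t) (above t (ℕP.<-trans (ℕP.n<1+n t) t<k))
    ... | tri≈ _ fi≡fl _ = ⊥-elim (ℕP.m≢1+m+n i (inj i<n l<n fi≡fl))
      where
      l<n = ℕP.<-≤-trans (ℕP.n<1+n _)
              (ℕP.≤-trans (ℕP.m≤m+n _ k) (subst (λ x → suc x + k ≤ n) (ℕP.+-suc i d) bound))
      i<n = ℕP.<-trans (s≤s (ℕP.m≤m+n i d)) l<n
    ... | tri> _ _ fl<fi = suc (i + d) , subst (λ x → suc x + k ≤ n) (ℕP.+-suc i d) bound ,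
      λ t t<k → ℕP.<-trans fl<fi (subst (λ x → f i < f x) (shift i d t) (above t t<k))

  valueAt : ∀ {N} → List (Fin N) → ℕ → ℕ
  valueAt []      _       = 0
  valueAt (x ∷ l) zero    = toℕ x
  valueAt (x ∷ l) (suc i) = valueAt l i

  segmentedOccurrence-cong : ∀ {k n f g} → (∀ m → m < n → f m ≡ g m) →
    SegmentedOccurrence k n f → SegmentedOccurrence k n g
  segmentedOccurrence-cong {k} {n} {f} {g} f≗g (i , i+k<n , rises) = i , i+k<n , λ t t<k →
    subst₂ _<_ (f≗g i (ℕP.≤-<-trans (ℕP.m≤m+n i k) i+k<n))
               (f≗g (i + suc t) (ℕP.≤-<-trans (ℕP.+-monoʳ-≤ i t<k) i+k<n)) (rises t t<k)

module _ where
  open import Data.Nat using (_+_; _<ᵇ_)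
  open import Data.Bool using (_∧_; not)
  import Data.Bool.Properties as BoolP
  open import Data.Product using (_×_; _,_)

  startsOccurrence⇒ : ∀ {N} k (x : Fin N) ys → startsOccurrence k x ys ≡ true →
    k ≤ length ys × (∀ t → t < k → toℕ x < valueAt ys t)
  startsOccurrence⇒ zero    x ys       _      = z≤n , λ _ ()
  startsOccurrence⇒ (suc k) x (y ∷ ys) starts with startsOccurrence⇒ k x ys (BoolP.∧-conicalʳ _ _ starts)
  ... | k≤|ys| , below = s≤s k≤|ys| , λ where
    zero    _         → ℕP.<ᵇ⇒< (toℕ x) (toℕ y) (Equivalence.from BoolP.T-≡ (BoolP.∧-conicalˡ _ _ starts))
    (suc t) (s≤s t<k) → below t t<k

  startsOccurrence⇐ : ∀ {N} k (x : Fin N) ys → k ≤ length ys → (∀ t → t < k → toℕ x < valueAt ys t) →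
    startsOccurrence k x ys ≡ true
  startsOccurrence⇐ zero    x ys       _              _     = refl
  startsOccurrence⇐ (suc k) x (y ∷ ys) (s≤s k≤|ys|) below = cong₂ _∧_
    (Equivalence.to BoolP.T-≡ (ℕP.<⇒<ᵇ (below 0 (s≤s z≤n))))
    (startsOccurrence⇐ k x ys k≤|ys| (λ t t<k → below (suc t) (s≤s t<k)))

  avoids-false⇒ : ∀ {N} k (l : List (Fin N)) → avoids k l ≡ false → SegmentedOccurrence k (length l) (valueAt l)
  avoids-false⇒ k (x ∷ ys) avoidsFalse with startsOccurrence k x ys in starts
  ... | true  = let k≤|ys| , below = startsOccurrence⇒ k x ys starts in 0 , s≤s k≤|ys| , below
  ... | false = let i , i+k<|ys| , rises = avoids-false⇒ k ys avoidsFalse in suc i , s≤s i+k<|ys| , rises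

  occurrence⇒avoids-false : ∀ {N} k (l : List (Fin N)) → SegmentedOccurrence k (length l) (valueAt l) → avoids k l ≡ false
  occurrence⇒avoids-false k (x ∷ ys) (zero  , s≤s k≤|ys| , rises) =
    cong (λ b → not b ∧ avoids k ys) (startsOccurrence⇐ k x ys k≤|ys| rises)
  occurrence⇒avoids-false k (x ∷ ys) (suc i , s≤s i+k<|ys| , rises) =
    trans (cong (not (startsOccurrence k x ys) ∧_) (occurrence⇒avoids-false k ys (i , i+k<|ys| , rises))) (BoolP.∧-zeroʳ _)

-- Permutations

module _ where
  open import Data.Nat using (_+_; _<?_)
  open import Data.Bool using (_∧_; _∨_; not)
  import Data.Bool.Properties as BoolP
  open import Data.Vec using (Vec; []; _∷_; lookup; toList)
  open import Data.Product using (_×_; _,_)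
  open import Data.Empty using (⊥-elim)
  open import Relation.Nullary using (does; ¬_)
  open import Relation.Nullary.Decidable using (dec-true; dec-false)
  import Data.Fin.Properties as FinP

  true≢false : true ≢ false
  true≢false ()

  LookupInjective : ∀ {A : Set} {m} → Vec A m → Set
  LookupInjective {m = m} v = ∀ (i j : Fin m) → lookup v i ≡ lookup v j → i ≡ j

  noRepeatsAfter-toList⁺ : ∀ {N m} (U : List (Fin N)) (v : Vec (Fin N) m) →
    LookupInjective v → (∀ i → lookup v i ∈ᵇ U ≡ false) → noRepeatsAfter U (toList v) ≡ true
  noRepeatsAfter-toList⁺ U []      _   _     = refl
  noRepeatsAfter-toList⁺ U (x ∷ v) inj fresh = cong₂ _∧_ (cong not (fresh Fin.zero))
    (noRepeatsAfter-toList⁺ (x ∷ U) v (λ i j eq → FinP.suc-injective (inj (Fin.suc i) (Fin.suc j) eq))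
      (λ i → cong₂ _∨_ (dec-false (lookup v i Fin.≟ x) (λ eq → FinP.0≢1+n (sym (inj (Fin.suc i) Fin.zero eq))))
                       (fresh (Fin.suc i))))

  noRepeatsAfter-toList⁻ : ∀ {N m} (U : List (Fin N)) (v : Vec (Fin N) m) →
    noRepeatsAfter U (toList v) ≡ true → LookupInjective v × (∀ i → lookup v i ∈ᵇ U ≡ false)
  noRepeatsAfter-toList⁻ U []      _         = (λ ()) , (λ ())
  noRepeatsAfter-toList⁻ U (x ∷ v) noRepeats with x ∈ᵇ U in x∈U
  ... | false with noRepeatsAfter-toList⁻ (x ∷ U) v noRepeats
  ...   | inj , fresh = inj′ , fresh′
    where
    x≢ : ∀ i → x ≢ lookup v i
    x≢ i x≡vᵢ = true≢false (trans (sym (dec-true (lookup v i Fin.≟ x) (sym x≡vᵢ))) (BoolP.∨-conicalˡ _ _ (fresh i)))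
    inj′ : LookupInjective (x ∷ v)
    inj′ Fin.zero    Fin.zero    _  = refl
    inj′ Fin.zero    (Fin.suc j) eq = ⊥-elim (x≢ j eq)
    inj′ (Fin.suc i) Fin.zero    eq = ⊥-elim (x≢ i (sym eq))
    inj′ (Fin.suc i) (Fin.suc j) eq = cong Fin.suc (inj i j eq)
    fresh′ : ∀ i → lookup (x ∷ v) i ∈ᵇ U ≡ false
    fresh′ Fin.zero    = x∈U
    fresh′ (Fin.suc i) = BoolP.∨-conicalʳ _ _ (fresh i)

  at-fromℕ< : ∀ {n m} (π : Word n) (m<n : m < n) → at π m ≡ toℕ (lookup π (Fin.fromℕ< m<n))
  at-fromℕ< {n} {m} π m<n with m <? n
  ... | yes _   = refl
  ... | no  m≮n = ⊥-elim (m≮n m<n)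

  valueAt-toList : ∀ {N m i} (v : Vec (Fin N) m) (i<m : i < m) → valueAt (toList v) i ≡ toℕ (lookup v (Fin.fromℕ< i<m))
  valueAt-toList {i = zero}  (x ∷ v) _         = refl
  valueAt-toList {i = suc i} (x ∷ v) (s≤s i<m) = valueAt-toList v i<m

  at≗valueAt : ∀ {n} (π : Word n) m → m < n → at π m ≡ valueAt (toList π) m
  at≗valueAt π m m<n = trans (at-fromℕ< π m<n) (sym (valueAt-toList π m<n))

  isPerm⇒injectiveBelow : ∀ {n} (π : Word n) → IsPerm π → InjectiveBelow n (at π)
  isPerm⇒injectiveBelow π perm {a} {b} a<n b<n eq = FinP.fromℕ<-injective a b a<n b<n
    (perm _ _ (FinP.toℕ-injective (trans (sym (at-fromℕ< π a<n)) (trans eq (at-fromℕ< π b<n)))))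

  occSeg⇒segmented : ∀ {n} k (π : Word n) → OccSeg k π → SegmentedOccurrence k n (at π)
  occSeg⇒segmented k π (i , i+k<n , rises) = toℕ i , i+k<n , λ t t<k →
    subst (λ s → at π (toℕ i) < at π (toℕ i + suc s)) (FinP.toℕ-fromℕ< t<k) (rises (Fin.fromℕ< t<k))

  segmented⇒occSeg : ∀ {n} k (π : Word n) → SegmentedOccurrence k n (at π) → OccSeg k π
  segmented⇒occSeg {n} k π (i , i+k<n , rises) =
    Fin.fromℕ< i<n , subst (λ x → x + k < n) (sym toℕ-i) i+k<n ,
    λ t → subst (λ x → at π x < at π (x + suc (toℕ t))) (sym toℕ-i) (rises (toℕ t) (FinP.toℕ<n t))
    where
    i<n = ℕP.≤-<-trans (ℕP.m≤m+n i k) i+k<n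
    toℕ-i = FinP.toℕ-fromℕ< i<n

  occDashed⇒dashed : ∀ {n} k (π : Word n) → OccDashed k π → DashedOccurrence k n (at π)
  occDashed⇒dashed k π (i , j , i<j , j+k≤n , above) = toℕ i , toℕ j , i<j , j+k≤n , λ t t<k →
    subst (λ s → at π (toℕ i) < at π (toℕ j + s)) (FinP.toℕ-fromℕ< t<k) (above (Fin.fromℕ< t<k))

  -- k ≥ 1 guarantees that the position of a₁ is a valid index.
  dashed⇒occDashed : ∀ {n} k → 1 ≤ k → (π : Word n) → DashedOccurrence k n (at π) → OccDashed k π
  dashed⇒occDashed {n} k 1≤k π (i , j , i<j , j+k≤n , above) =
    Fin.fromℕ< i<n , Fin.fromℕ< j<n , subst₂ _<_ (sym toℕ-i) (sym toℕ-j) i<j ,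
    subst (λ x → x + k ≤ n) (sym toℕ-j) j+k≤n ,
    λ t → subst₂ (λ x y → at π x < at π (y + toℕ t)) (sym toℕ-i) (sym toℕ-j) (above (toℕ t) (FinP.toℕ<n t))
    where
    j<n = ℕP.<-≤-trans (ℕP.m<m+n j 1≤k) j+k≤n
    i<n = ℕP.<-trans i<j j<n
    toℕ-i = FinP.toℕ-fromℕ< i<n
    toℕ-j = FinP.toℕ-fromℕ< j<n

  avoidsDashed⇔avoidsSegmented : ∀ k → 1 ≤ k → (n : ℕ) (π : Word n) → IsPerm π →
                                 (¬ OccDashed k π) ⇔ (¬ OccSeg k π)
  avoidsDashed⇔avoidsSegmented k 1≤k n π perm = mk⇔
    (λ ¬dashed seg → ¬dashed (dashed⇒occDashed k 1≤k π (segmented⇒dashed (occSeg⇒segmented k π seg))))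
    (λ ¬seg dashed → ¬seg (segmented⇒occSeg k π
      (dashed⇒segmented (isPerm⇒injectiveBelow π perm) (occDashed⇒dashed k π dashed))))

module _ where
  open import Data.Nat using (_+_; _*_)
  open import Data.Nat.ListAction using (sum)
  open import Data.Nat.ListAction.Properties using (sum-++)
  open import Data.List using (filter; concatMap; allFin; tabulate)
  open import Data.Vec using (Vec; []; _∷_; toList)
  import Data.Vec.Properties as VecP
  open import Data.Product using (proj₁)
  open import Data.Empty using (⊥-elim)
  open import Relation.Nullary using (Dec; does; proof; ¬_; ¬?)
  open import Relation.Nullary.Reflects using (det; fromEquivalence)
  open import Relation.Unary using (Decidable)
  import Data.Bool.Properties as BoolP
  open import Algebra.Properties.Semiring.Sum ℕP.+-*-semiring using (sum-syntax; sum-cong-≗)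
  open ≡-Reasoning

  does-≡ : ∀ {P : Set} (P? : Dec P) {b} → (P → b ≡ true) → (b ≡ true → P) → does P? ≡ b
  does-≡ P? to from = det (proof P?) (fromEquivalence (from ∘ Equivalence.to BoolP.T-≡) (Equivalence.from BoolP.T-≡ ∘ to))

  does-isPerm? : ∀ {n} (π : Word n) → does (isPerm? π) ≡ noRepeatsAfter [] (toList π)
  does-isPerm? π = does-≡ (isPerm? π) (λ perm → noRepeatsAfter-toList⁺ [] π perm (λ _ → refl))
                                      (λ noRepeats → proj₁ (noRepeatsAfter-toList⁻ [] π noRepeats))

  does-¬occSeg? : ∀ {n} k (π : Word n) → does (¬? (occSeg? k π)) ≡ avoids k (toList π)
  does-¬occSeg? {n} k π = does-≡ (¬? (occSeg? k π)) avoiding occurrenceFree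
    where
    l = toList π
    |l|≡n : length l ≡ n
    |l|≡n = VecP.length-toList π
    toListOccurrence : OccSeg k π → SegmentedOccurrence k (length l) (valueAt l)
    toListOccurrence occ = subst (λ m → SegmentedOccurrence k m (valueAt l)) (sym |l|≡n)
      (segmentedOccurrence-cong (at≗valueAt π) (occSeg⇒segmented k π occ))
    fromListOccurrence : SegmentedOccurrence k (length l) (valueAt l) → OccSeg k π
    fromListOccurrence occ = segmented⇒occSeg k π (segmentedOccurrence-cong (λ m m<n → sym (at≗valueAt π m m<n))
      (subst (λ m → SegmentedOccurrence k m (valueAt l)) |l|≡n occ))
    avoiding : ¬ OccSeg k π → avoids k l ≡ true
    avoiding ¬occ with avoids k l in avoidsFalse
    ... | true  = refl
    ... | false = ⊥-elim (¬occ (fromListOccurrence (avoids-false⇒ k l avoidsFalse)))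
    occurrenceFree : avoids k l ≡ true → ¬ OccSeg k π
    occurrenceFree avoidsTrue occ = true≢false (trans (sym avoidsTrue) (occurrence⇒avoids-false k l (toListOccurrence occ)))

  length-filter-filter : ∀ {A : Set} {P Q : A → Set} (P? : Decidable P) (Q? : Decidable Q) xs →
    length (filter P? (filter Q? xs)) ≡ sum (map (λ x → ⟦ does (Q? x) ⟧ * ⟦ does (P? x) ⟧) xs)
  length-filter-filter P? Q? [] = refl
  length-filter-filter P? Q? (x ∷ xs) with does (Q? x)
  ... | false = length-filter-filter P? Q? xs
  ... | true with does (P? x)
  ...   | true  = cong suc (length-filter-filter P? Q? xs)
  ...   | false = length-filter-filter P? Q? xs

  sum-map-concatMap : ∀ {A B : Set} (g : B → ℕ) (h : A → List B) xs →
    sum (map g (concatMap h xs)) ≡ sum (map (λ x → sum (map g (h x))) xs)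
  sum-map-concatMap g h []       = refl
  sum-map-concatMap g h (x ∷ xs) = begin
    sum (map g (h x ++ concatMap h xs))             ≡⟨ cong sum (ListP.map-++ g (h x) _) ⟩
    sum (map g (h x) ++ map g (concatMap h xs))     ≡⟨ sum-++ (map g (h x)) _ ⟩
    sum (map g (h x)) + sum (map g (concatMap h xs)) ≡⟨ cong (sum (map g (h x)) +_) (sum-map-concatMap g h xs) ⟩
    sum (map g (h x)) + sum (map (λ x → sum (map g (h x))) xs) ∎

  sum-map-tabulate : ∀ {A : Set} N (h : Fin N → A) (f : A → ℕ) → sum (map f (tabulate h)) ≡ ∑[ x < N ] f (h x)
  sum-map-tabulate zero    h f = refl
  sum-map-tabulate (suc N) h f = cong (f (h Fin.zero) +_) (sum-map-tabulate N (h ∘ Fin.suc) f)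

  sum-map-words : ∀ N m (g : Vec (Fin N) m → ℕ) (w : List (Fin N) → ℕ) → (∀ v → g v ≡ w (toList v)) →
    sum (map g (words N m)) ≡ sumWords N m w
  sum-map-words N zero    g w g≗w = trans (ℕP.+-identityʳ (g [])) (g≗w [])
  sum-map-words N (suc m) g w g≗w = begin
    sum (map g (concatMap (λ x → map (x ∷_) (words N m)) (allFin N)))
      ≡⟨ sum-map-concatMap g _ (allFin N) ⟩
    sum (map (λ x → sum (map g (map (x ∷_) (words N m)))) (allFin N))
      ≡⟨ sum-map-tabulate N (λ x → x) _ ⟩
    ∑[ x < N ] sum (map g (map (x ∷_) (words N m)))
      ≡⟨ sum-cong-≗ (λ x → trans (cong sum (sym (ListP.map-∘ (words N m))))
           (sum-map-words N m (λ v → g (x ∷ v)) (λ l → w (x ∷ l)) (λ v → g≗w (x ∷ v)))) ⟩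
    ∑[ x < N ] sumWords N m (λ l → w (x ∷ l))
      ∎

  countSegAvoid≡avoiders : ∀ k n → countSegAvoid k n ≡ avoiders k n n
  countSegAvoid≡avoiders k n = trans (length-filter-filter (λ π → ¬? (occSeg? k π)) isPerm? (words n n))
    (sum-map-words n n _ (weight k) (λ π → cong₂ _*_ (cong ⟦_⟧ (does-isPerm? π)) (cong ⟦_⟧ (does-¬occSeg? k π))))

module _ where
  open import Data.Integer using (+_)
  open import Data.Rational using (_*_)
  open ℚSolver.+-*-Solver using (solve; _:*_; _:=_)
  open ≡-Reasoning

  countSegAvoid-egf : ∀ k n → (+ countSegAvoid k n) /fact n ≡ expS (logSeries k) n
  countSegAvoid-egf k n = begin
    (+ countSegAvoid k n) /fact n                ≡⟨ /-as-* (countSegAvoid k n) (n !) {{n !≢0}} ⟩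
    fromℕ (countSegAvoid k n) * u                ≡⟨ cong (λ c → fromℕ c * u) (countSegAvoid≡avoiders k n) ⟩
    fromℕ (avoiders k n n) * u                   ≡⟨ cong (_* u) (avoiders-closedForm k n n) ⟩
    fromℕ (n ↓ n) * E * u                        ≡⟨ cong (λ m → fromℕ m * E * u) (↓-diagonal n) ⟩
    fromℕ (n !) * E * u                          ≡⟨ solve 3 (λ a e v → a :* e :* v := e :* (a :* v)) refl (fromℕ (n !)) E u ⟩
    E * (fromℕ (n !) * u)                        ≡⟨ cong (E *_) (fromℕ-*-inverse (n !) {{n !≢0}}) ⟩
    E * 1ℚ                                       ≡⟨ ℚP.*-identityʳ E ⟩
    E                                            ∎
    where
    E = expS (logSeries k) n
    u = (+ 1) /fact n

open import Data.Integer using (+_)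
open import Data.Product using (_×_; _,_)
open import Relation.Nullary using (¬_)

mainTheorem3 : (k : ℕ) → 1 ≤ k →
    ((n : ℕ) (π : Word n) → IsPerm π → ((¬ OccDashed k π) ⇔ (¬ OccSeg k π)))
    × ((n : ℕ) → (+ countSegAvoid k n) /fact n ≡ expS (logSeries k) n)
mainTheorem3 k 1≤k = avoidsDashed⇔avoidsSegmented k 1≤k , countSegAvoid-egf k
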